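{- Let $k\ge 2$ and let $v_i,v_j$ be two distinct inner vertices of $GP(2k+1,2)$ with $r=|i-j|\le k$. Then the number $\sigma(v_i,v_j)$ of geodesics between $v_i$ and $v_j$ is $$\sigma(v_i,v_j)=\begin{cases}1 & r \text{ even},\\ 1 & r \text{ odd},\ r>k-2,\\ \frac{r+1}{2} & r\text{ odd},\ r<k-2,\\ \frac{r+3}{2} & r\text{ odd},\ r=k-2.\end{cases}$$
   Context: For an integer $n\ge 5$, $GP(n,2)$ is the graph with vertex set $\{u_0,\dots,u_{n-1},v_0,\dots,v_{n-1}\}$ and edges $u_iu_{i+1}$ (outer edges), $u_iv_i$ (spokes) and $v_iv_{i+2}$ (inner edges) for $0\le i\le n-1$, subscripts modulo $n$. The $u_i$ are outer vertices, the $v_i$ inner vertices (for odd $n$ they form a single inner cycle). A geodesic is a shortest path; $\sigma(x,y)$ denotes the number of geodesics between $x$ and $y$. -}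

module Defs where

open import Data.Nat using (ℕ; zero; suc; _+_; _*_; _∸_; NonZero; _%_)
open import Data.Nat.DivMod using (m%n<n)
open import Data.Fin using (Fin; toℕ; fromℕ<)
open import Data.Fin.Properties using () renaming (_≟_ to _≟ᶠ_)
open import Data.Bool using (Bool; true; false; _∨_; if_then_else_)
open import Data.List using (List; map; _++_; allFin)
open import Data.Nat.ListAction using (sum)
open import Relation.Nullary.Decidable using (⌊_⌋)

-- Vertices of GP(n,2): outer u_i and inner v_i, i ∈ ℤ_n.
data Vtx (n : ℕ) : Set where
  outer : Fin n → Vtx n
  inner : Fin n → Vtx n

shift : ∀ {n} .{{_ : NonZero n}} → Fin n → ℕ → Fin n
shift {n} i m = fromℕ< (m%n<n (toℕ i + m) n)

vertices : ∀ n → List (Vtx n)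
vertices n = map outer (allFin n) ++ map inner (allFin n)

eqV : ∀ {n} → Vtx n → Vtx n → Bool
eqV (outer i) (outer j) = ⌊ i ≟ᶠ j ⌋
eqV (inner i) (inner j) = ⌊ i ≟ᶠ j ⌋
eqV _ _ = false

-- directed "edge generator": x y is one of u_i u_{i+1}, u_i v_i, v_i v_{i+2}
edgeGen : ∀ {n} .{{_ : NonZero n}} → Vtx n → Vtx n → Bool
edgeGen (outer i) (outer j) = ⌊ shift i 1 ≟ᶠ j ⌋
edgeGen (outer i) (inner j) = ⌊ i ≟ᶠ j ⌋
edgeGen (inner i) (outer j) = false
edgeGen (inner i) (inner j) = ⌊ shift i 2 ≟ᶠ j ⌋

adj : ∀ {n} .{{_ : NonZero n}} → Vtx n → Vtx n → Bool
adj x y = edgeGen x y ∨ edgeGen y x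

b2n : Bool → ℕ
b2n true = 1
b2n false = 0

numWalks : ∀ {n} .{{_ : NonZero n}} → ℕ → Vtx n → Vtx n → ℕ
numWalks zero x y = b2n (eqV x y)
numWalks {n} (suc L) x y = sum (map (λ w → b2n (adj x w) * numWalks L w y) (vertices n))

-- least L in [s, s+fuel) with f L > 0 (default s+fuel)
firstPos : (ℕ → ℕ) → ℕ → ℕ → ℕ
firstPos f s zero = s
firstPos f s (suc fuel) with f s
... | zero = firstPos f (suc s) fuel
... | suc _ = s

-- distance d(x,y): least length of a walk from x to y (searching lengths < 2n,
-- the number of vertices, which suffices since GP(n,2) is connected)
dist : ∀ {n} .{{_ : NonZero n}} → Vtx n → Vtx n → ℕ
dist {n} x y = firstPos (λ L → numWalks L x y) 0 (n + n)

-- σ(x,y): number of geodesics = number of walks of length d(x,y)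
-- (walks of minimal length are exactly the shortest paths)
σ : ∀ {n} .{{_ : NonZero n}} → Vtx n → Vtx n → ℕ
σ x y = numWalks (dist x y) x y

-- Fix the target v_j and let Wᵢ L t, Wₒ L t count the walks of length L from v_{j+t}, u_{j+t}
-- to v_j, offsets being taken modulo N = 2k+1. They satisfy the neighbourhood recurrences of
-- GP(N,2) and are invariant under t ↦ −t. The distances dᵢ, dₒ to v_0 in the infinite graph
-- GP(ℤ,2), read the shorter way round the cycle, change by at most one along every edge and
-- vanish only at v_j, so no walk is shorter than this potential; exhibiting walks of exactly
-- that length identifies the distance and σ. An even offset 2a is reached by a unique walk
-- along the inner cycle. A geodesic to an odd offset 1 + 2a (with a + 3 ≤ k − a) crosses the
-- outer cycle once, at any of a + 1 places, and when r = k − 2 one more geodesic goes round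
-- the other side; for r > k − 2 the other side is strictly shorter and again unique.

module Submission where

open import Defs
open import Algebra.Properties.CommutativeSemigroup using (interchange)
open import Data.Bool using (Bool; true; false; T; _∨_)
open import Data.Bool.Properties using (∨-identityʳ)
open import Data.Empty using (⊥; ⊥-elim)
open import Data.Fin using (Fin; toℕ) renaming (zero to fzero; suc to fsuc)
open import Data.Fin.Properties using (toℕ-fromℕ<; toℕ-injective; toℕ<n; all?)
  renaming (_≟_ to _≟ᶠ_; suc-injective to fsuc-injective)
open import Data.List using (map; tabulate; allFin; _++_)
open import Data.List.Properties using (map-++; map-∘; map-tabulate; tabulate-cong)
open import Data.Nat
open import Data.Nat.DivMod
open import Data.Nat.Divisibility using (∣-refl)
open import Data.Nat.ListAction using (sum)
open import Data.Nat.ListAction.Properties using (sum-++)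
open import Data.Nat.Properties
open import Data.Nat.Tactic.RingSolver using (solve-∀)
open import Data.Product using (_×_; _,_; proj₁; proj₂; ∃₂)
open import Data.Sum using (inj₁; inj₂)
open import Function using (_∘_; _⇔_; mk⇔; case_of_)
open import Relation.Binary.Definitions using (tri<; tri≈; tri>)
open import Relation.Binary.PropositionalEquality
open import Relation.Nullary using (Dec; contradiction)
open import Relation.Nullary.Decidable using (⌊_⌋; toWitness; fromWitness; isYes≗does; does-⇔; dec-false)

sum-tabulate-+ : ∀ {n} (f g : Fin n → ℕ) →
  sum (tabulate (λ x → f x + g x)) ≡ sum (tabulate f) + sum (tabulate g)
sum-tabulate-+ {zero} f g = refl
sum-tabulate-+ {suc n} f g = begin
  f fzero + g fzero + sum (tabulate (λ x → f (fsuc x) + g (fsuc x)))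
    ≡⟨ cong (f fzero + g fzero +_) (sum-tabulate-+ (f ∘ fsuc) (g ∘ fsuc)) ⟩
  f fzero + g fzero + (sum (tabulate (f ∘ fsuc)) + sum (tabulate (g ∘ fsuc)))
    ≡⟨ interchange +-commutativeSemigroup (f fzero) (g fzero) _ _ ⟩
  f fzero + sum (tabulate (f ∘ fsuc)) + (g fzero + sum (tabulate (g ∘ fsuc))) ∎
  where open ≡-Reasoning

sum-tabulate-δ : ∀ {n} (a : Fin n) (G : Fin n → ℕ) → (∀ x → x ≢ a → G x ≡ 0) →
  sum (tabulate G) ≡ G a
sum-tabulate-δ {suc n} fzero G G≡0 =
  trans (cong (G fzero +_) (sum-zero (G ∘ fsuc) (λ x → G≡0 (fsuc x) λ ()))) (+-identityʳ _)
  where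
  sum-zero : ∀ {m} (H : Fin m → ℕ) → (∀ x → H x ≡ 0) → sum (tabulate H) ≡ 0
  sum-zero {zero} H H≡0 = refl
  sum-zero {suc m} H H≡0 = cong₂ _+_ (H≡0 fzero) (sum-zero (H ∘ fsuc) (H≡0 ∘ fsuc))
sum-tabulate-δ {suc n} (fsuc a) G G≡0 =
  cong₂ _+_ (G≡0 fzero λ ()) (sum-tabulate-δ a (G ∘ fsuc) λ x x≢a → G≡0 (fsuc x) (x≢a ∘ fsuc-injective))

sum-indicator : ∀ {n} (a : Fin n) (p : Fin n → Bool) (F : Fin n → ℕ) →
  T (p a) → (∀ x → T (p x) → x ≡ a) → sum (tabulate (λ x → b2n (p x) * F x)) ≡ F a
sum-indicator a p F pa p⇒a = trans (sum-tabulate-δ a _ vanish) (at-a (p a) pa)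
  where
  at-a : ∀ b → T b → b2n b * F a ≡ F a
  at-a true _ = +-identityʳ (F a)
  vanish : ∀ x → x ≢ a → b2n (p x) * F x ≡ 0
  vanish x x≢a with p x | p⇒a x
  ... | true  | x≡a = contradiction (x≡a _) x≢a
  ... | false | _   = refl

sum-vertices : ∀ {n} (G : Vtx n → ℕ) →
  sum (map G (vertices n)) ≡ sum (tabulate (G ∘ outer)) + sum (tabulate (G ∘ inner))
sum-vertices {n} G = begin
  sum (map G (map outer (allFin n) ++ map inner (allFin n)))
    ≡⟨ cong sum (map-++ G (map outer (allFin n)) _) ⟩
  sum (map G (map outer (allFin n)) ++ map G (map inner (allFin n)))
    ≡⟨ sum-++ (map G (map outer (allFin n))) _ ⟩
  sum (map G (map outer (allFin n))) + sum (map G (map inner (allFin n)))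
    ≡⟨ cong₂ (λ xs ys → sum xs + sum ys) (on-tabulate outer) (on-tabulate inner) ⟩
  sum (tabulate (G ∘ outer)) + sum (tabulate (G ∘ inner)) ∎
  where
  open ≡-Reasoning
  on-tabulate : (h : Fin n → Vtx n) → map G (map h (allFin n)) ≡ tabulate (G ∘ h)
  on-tabulate h = trans (sym (map-∘ (allFin n))) (map-tabulate (λ x → x) (G ∘ h))

b2n-∨-* : ∀ p q m → (T p → T q → ⊥) → b2n (p ∨ q) * m ≡ b2n p * m + b2n q * m
b2n-∨-* true  true  m p∧q = ⊥-elim (p∧q _ _)
b2n-∨-* true  false m _   = sym (+-identityʳ _)
b2n-∨-* false q     m _   = refl

⌊⌋-⇔ : ∀ {A B : Set} → A ⇔ B → (a? : Dec A) (b? : Dec B) → ⌊ a? ⌋ ≡ ⌊ b? ⌋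
⌊⌋-⇔ A⇔B a? b? = trans (isYes≗does a?) (trans (does-⇔ A⇔B a? b?) (sym (isYes≗does b?)))

firstPos-least : ∀ f s fuel d → s ≤ d → d < s + fuel →
  (∀ L → s ≤ L → L < d → f L ≡ 0) → 0 < f d → firstPos f s fuel ≡ d
firstPos-least f s zero d s≤d d<s+0 _ _ =
  ⊥-elim (<-irrefl refl (≤-<-trans s≤d (subst (d <_) (+-identityʳ s) d<s+0)))
firstPos-least f s (suc fuel) d s≤d d<s+fuel zeros pos with f s in fs≡
... | zero = firstPos-least f (suc s) fuel d s<d (subst (d <_) (+-suc s fuel) d<s+fuel)
               (λ L s<L → zeros L (<⇒≤ s<L)) pos
  where
  s<d : s < d
  s<d = ≤∧≢⇒< s≤d λ { refl → <⇒≢ pos (sym fs≡) }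
... | suc _ with m≤n⇒m<n∨m≡n s≤d
...   | inj₁ s<d = case trans (sym (zeros s ≤-refl s<d)) fs≡ of λ ()
...   | inj₂ s≡d = s≡d

σ≡numWalks : ∀ {n} .{{_ : NonZero n}} (x y : Vtx n) d → d < n + n →
  (∀ L → L < d → numWalks L x y ≡ 0) → 0 < numWalks d x y → σ x y ≡ numWalks d x y
σ≡numWalks {n} x y d d<2n zeros pos = cong (λ L → numWalks L x y)
  (firstPos-least (λ L → numWalks L x y) 0 (n + n) d z≤n d<2n (λ L _ → zeros L) pos)

infix 4 _≈₁_
_≈₁_ : ℕ → ℕ → Set
m ≈₁ n = m ≤ suc n × n ≤ suc m

≈₁-sym : ∀ {m n} → m ≈₁ n → n ≈₁ m
≈₁-sym (m≤1+n , n≤1+m) = n≤1+m , m≤1+n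

≈₁-reflexive : ∀ {m n} → m ≡ n → m ≈₁ n
≈₁-reflexive refl = n≤1+n _ , n≤1+n _

⊓-≈₁ : ∀ {a b c d} → a ≈₁ b → c ≈₁ d → a ⊓ c ≈₁ b ⊓ d
⊓-≈₁ (a≤ , b≤) (c≤ , d≤) = ⊓-mono-≤ a≤ c≤ , ⊓-mono-≤ b≤ d≤

module Cycle (M : ℕ) where

  N : ℕ
  N = suc M

  %-absorbˡ : ∀ m n → (m % N + n) % N ≡ (m + n) % N
  %-absorbˡ m n = begin
    (m % N + n) % N         ≡⟨ %-distribˡ-+ (m % N) n N ⟩
    (m % N % N + n % N) % N ≡⟨ cong (λ x → (x + n % N) % N) (m%n%n≡m%n m N) ⟩
    (m % N + n % N) % N     ≡⟨ %-distribˡ-+ m n N ⟨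
    (m + n) % N             ∎
    where open ≡-Reasoning

  %-absorbʳ : ∀ m n → (m + n % N) % N ≡ (m + n) % N
  %-absorbʳ m n = begin
    (m + n % N) % N ≡⟨ cong (_% N) (+-comm m (n % N)) ⟩
    (n % N + m) % N ≡⟨ %-absorbˡ n m ⟩
    (n + m) % N     ≡⟨ cong (_% N) (+-comm n m) ⟩
    (m + n) % N     ∎
    where open ≡-Reasoning

  toℕ-shift : ∀ (i : Fin N) a → toℕ (shift i a) ≡ (toℕ i + a) % N
  toℕ-shift i a = toℕ-fromℕ< _

  shift-cong : ∀ (i : Fin N) {a b} → a % N ≡ b % N → shift i a ≡ shift i b
  shift-cong i {a} {b} a≡b = toℕ-injective (begin
    toℕ (shift i a)     ≡⟨ toℕ-shift i a ⟩
    (toℕ i + a) % N     ≡⟨ %-absorbʳ (toℕ i) a ⟨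
    (toℕ i + a % N) % N ≡⟨ cong (λ x → (toℕ i + x) % N) a≡b ⟩
    (toℕ i + b % N) % N ≡⟨ %-absorbʳ (toℕ i) b ⟩
    (toℕ i + b) % N     ≡⟨ toℕ-shift i b ⟨
    toℕ (shift i b)     ∎)
    where open ≡-Reasoning

  shift-shift : ∀ (i : Fin N) a b → shift (shift i a) b ≡ shift i (a + b)
  shift-shift i a b = toℕ-injective (begin
    toℕ (shift (shift i a) b)   ≡⟨ toℕ-shift (shift i a) b ⟩
    (toℕ (shift i a) + b) % N   ≡⟨ cong (λ x → (x + b) % N) (toℕ-shift i a) ⟩
    ((toℕ i + a) % N + b) % N   ≡⟨ %-absorbˡ (toℕ i + a) b ⟩
    (toℕ i + a + b) % N         ≡⟨ cong (_% N) (+-assoc (toℕ i) a b) ⟩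
    (toℕ i + (a + b)) % N       ≡⟨ toℕ-shift i (a + b) ⟨
    toℕ (shift i (a + b))       ∎)
    where open ≡-Reasoning

  shift-trivial : ∀ (i : Fin N) {a} → a % N ≡ 0 → shift i a ≡ i
  shift-trivial i {a} a≡0 = toℕ-injective (begin
    toℕ (shift i a)     ≡⟨ toℕ-shift i a ⟩
    (toℕ i + a) % N     ≡⟨ %-absorbʳ (toℕ i) a ⟨
    (toℕ i + a % N) % N ≡⟨ cong (λ x → (toℕ i + x) % N) a≡0 ⟩
    (toℕ i + 0) % N     ≡⟨ cong (_% N) (+-identityʳ (toℕ i)) ⟩
    toℕ i % N           ≡⟨ m<n⇒m%n≡m (toℕ<n i) ⟩
    toℕ i               ∎)
    where open ≡-Reasoning

  shift-trivial⁻¹ : ∀ (i : Fin N) {a} → shift i a ≡ i → a % N ≡ 0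
  shift-trivial⁻¹ i {a} eq = begin
    a % N                       ≡⟨ %-remove-+ˡ a (∣-refl {N}) ⟨
    (N + a) % N                 ≡⟨ cong (_% N) regroup ⟩
    (x + a + (N ∸ x)) % N       ≡⟨ %-absorbˡ (x + a) (N ∸ x) ⟨
    ((x + a) % N + (N ∸ x)) % N ≡⟨ cong (λ y → (y + (N ∸ x)) % N) (trans (sym (toℕ-shift i a)) (cong toℕ eq)) ⟩
    (x + (N ∸ x)) % N           ≡⟨ cong (_% N) (m+[n∸m]≡n x≤N) ⟩
    N % N                       ≡⟨ n%n≡0 N ⟩
    0                           ∎
    where
    open ≡-Reasoning
    x : ℕ
    x = toℕ i
    x≤N : x ≤ N
    x≤N = <⇒≤ (toℕ<n i)
    regroup : N + a ≡ x + a + (N ∸ x)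
    regroup = begin
      N + a               ≡⟨ cong (_+ a) (m+[n∸m]≡n x≤N) ⟨
      x + (N ∸ x) + a     ≡⟨ +-assoc x (N ∸ x) a ⟩
      x + (N ∸ x + a)     ≡⟨ cong (x +_) (+-comm (N ∸ x) a) ⟩
      x + (a + (N ∸ x))   ≡⟨ +-assoc x a (N ∸ x) ⟨
      x + a + (N ∸ x)     ∎

  shift-back : ∀ (i : Fin N) {d} → d ≤ N → shift (shift i (N ∸ d)) d ≡ i
  shift-back i {d} d≤N = trans (shift-shift i (N ∸ d) d)
    (shift-trivial i (trans (cong (_% N) (m∸n+n≡m d≤N)) (n%n≡0 N)))

  shift-solve : ∀ {x i : Fin N} {d} → d ≤ N → shift x d ≡ i → x ≡ shift i (N ∸ d)
  shift-solve {x} {i} {d} d≤N refl = sym (trans (shift-shift x d (N ∸ d))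
    (shift-trivial x (trans (cong (_% N) (m+[n∸m]≡n d≤N)) (n%n≡0 N))))

  around : (ℕ → ℕ) → ℕ → ℕ
  around f s = f s ⊓ f (N ∸ s)

  -- For f symmetric about 0 on the cover ℤ, cyclic f t is f at the nearer of the two lifts
  -- t % N and t % N − N of the offset t.
  cyclic : (ℕ → ℕ) → ℕ → ℕ
  cyclic f t = around f (t % N)

  cyclic-periodic : ∀ f t → cyclic f (N + t) ≡ cyclic f t
  cyclic-periodic f t = cong (around f) (%-remove-+ˡ t (∣-refl {N}))

  cyclic-≤N : ∀ f {t} → t ≤ N → cyclic f t ≡ around f t
  cyclic-≤N f {t} t≤N with m≤n⇒m<n∨m≡n t≤N
  ... | inj₁ t<N = cong (around f) (m<n⇒m%n≡m t<N)
  ... | inj₂ refl = begin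
    around f (N % N)  ≡⟨ cong (around f) (n%n≡0 N) ⟩
    f 0 ⊓ f N         ≡⟨ ⊓-comm (f 0) (f N) ⟩
    f N ⊓ f 0         ≡⟨ cong (λ x → f N ⊓ f x) (n∸n≡0 N) ⟨
    around f N        ∎
    where open ≡-Reasoning

  cyclic-≈₁ : ∀ {f g} → (∀ p → f p ≈₁ g p) → ∀ t → cyclic f t ≈₁ cyclic g t
  cyclic-≈₁ f≈g t = ⊓-≈₁ (f≈g (t % N)) (f≈g (N ∸ t % N))

  ∸-split : ∀ δ {s} → δ + s ≤ N → N ∸ s ≡ δ + (N ∸ (δ + s))
  ∸-split δ {s} δ+s≤N = begin
    N ∸ s             ≡⟨ m+[n∸m]≡n (m+n≤o⇒m≤o∸n δ δ+s≤N) ⟨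
    δ + (N ∸ s ∸ δ)   ≡⟨ cong (δ +_) (∸-+-assoc N s δ) ⟩
    δ + (N ∸ (s + δ)) ≡⟨ cong (λ x → δ + (N ∸ x)) (+-comm s δ) ⟩
    δ + (N ∸ (δ + s)) ∎
    where open ≡-Reasoning

  module _ {f : ℕ → ℕ} {δ : ℕ} (lip : ∀ p → f p ≈₁ f (δ + p)) where

    around-step-inside : ∀ {s} → δ + s < N → around f s ≈₁ around f (δ + s)
    around-step-inside {s} δ+s<N rewrite ∸-split δ (<⇒≤ δ+s<N) =
      ⊓-≈₁ (lip s) (≈₁-sym (lip (N ∸ (δ + s))))

    around-step-onto-zero : ∀ {s} → δ + s ≡ N → around f s ≈₁ around f 0
    around-step-onto-zero {s} δ+s≡N =
      subst₂ _≈₁_ (cong₂ (λ x y → f s ⊓ f y) (+-identityʳ δ) N∸s≡δ)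
        (trans (cong (λ x → f x ⊓ f 0) δ+s≡N) (⊓-comm (f N) (f 0)))
        (⊓-≈₁ (lip s) (≈₁-sym (lip 0)))
      where
      N∸s≡δ : δ + 0 ≡ N ∸ s
      N∸s≡δ = trans (+-identityʳ δ) (trans (sym (m+n∸n≡m δ s)) (cong (_∸ s) δ+s≡N))

  -- The one step across 0 that does not land on 0: both sides are f M ⊓ f 1.
  around-wrap : ∀ f → 1 ≤ M → around f M ≈₁ around f ((2 + M) % N)
  around-wrap f 1≤M = subst (λ x → around f M ≈₁ around f x) (sym 2+M%N≡1)
    (≈₁-reflexive (trans (cong (λ x → f M ⊓ f x) (m+n∸n≡m 1 M)) (⊓-comm (f M) (f 1))))
    where
    2+M%N≡1 : (2 + M) % N ≡ 1
    2+M%N≡1 = trans ([m+n]%n≡m%n 1 N) (m<n⇒m%n≡m (s≤s 1≤M))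

  cyclic-step : ∀ {f δ} → 1 ≤ M → δ ≤ 2 → (∀ p → f p ≈₁ f (δ + p)) →
    ∀ t → cyclic f t ≈₁ cyclic f (δ + t)
  cyclic-step {f} {δ} 1≤M δ≤2 lip t =
    subst (λ x → cyclic f t ≈₁ around f x) (%-absorbʳ δ t) (around-step (t % N) (m%n<n t N))
    where
    around-step : ∀ s → s < N → around f s ≈₁ around f ((δ + s) % N)
    around-step s s<N with <-cmp (δ + s) N
    ... | tri< δ+s<N _ _ = subst (λ x → around f s ≈₁ around f x)
      (sym (m<n⇒m%n≡m δ+s<N)) (around-step-inside lip δ+s<N)
    ... | tri≈ _ δ+s≡N _ = subst (λ x → around f s ≈₁ around f x)
      (sym (trans (cong (_% N) δ+s≡N) (n%n≡0 N))) (around-step-onto-zero lip δ+s≡N)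
    ... | tri> _ _ N<δ+s = wrap (≤-antisym δ≤2 2≤δ) (≤-antisym (≤-pred s<N) M≤s)
      where
      M≤s : M ≤ s
      M≤s = +-cancelˡ-≤ 2 M s (≤-trans N<δ+s (+-monoˡ-≤ s δ≤2))
      2≤δ : 2 ≤ δ
      2≤δ = +-cancelʳ-≤ M 2 δ (≤-trans N<δ+s (+-monoʳ-≤ δ (≤-pred s<N)))
      wrap : ∀ {δ′ s′} → δ′ ≡ 2 → s′ ≡ M → around f s′ ≈₁ around f ((δ′ + s′) % N)
      wrap refl refl = around-wrap f 1≤M

  cyclic-step-back : ∀ {f δ} → 1 ≤ M → δ ≤ 2 → (∀ p → f p ≈₁ f (δ + p)) →
    ∀ t → cyclic f t ≈₁ cyclic f (N ∸ δ + t)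
  cyclic-step-back {f} {δ} 1≤M δ≤2 lip t =
    ≈₁-sym (subst (cyclic f (N ∸ δ + t) ≈₁_) there-and-back (cyclic-step 1≤M δ≤2 lip (N ∸ δ + t)))
    where
    δ≤N : δ ≤ N
    δ≤N = ≤-trans δ≤2 (s≤s 1≤M)
    there-and-back : cyclic f (δ + (N ∸ δ + t)) ≡ cyclic f t
    there-and-back =
      trans (cong (cyclic f) (trans (sym (+-assoc δ (N ∸ δ) t)) (cong (_+ t) (m+[n∸m]≡n δ≤N))))
      (cyclic-periodic f t)

module Neighbourhood (M : ℕ) (M≥4 : 4 ≤ M) where

  open Cycle M

  N≥5 : 5 ≤ N
  N≥5 = s≤s M≥4

  private
    both-ways : ∀ d → 0 < d → d + d < N → (i : Fin N) (F : Fin N → ℕ) →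
      sum (tabulate (λ w → b2n (⌊ shift i d ≟ᶠ w ⌋ ∨ ⌊ shift w d ≟ᶠ i ⌋) * F w))
        ≡ F (shift i d) + F (shift i (N ∸ d))
    both-ways d 0<d 2d<N i F = begin
      sum (tabulate (λ w → b2n (p w ∨ q w) * F w))
        ≡⟨ cong sum (tabulate-cong λ w → b2n-∨-* (p w) (q w) (F w) (not-both w)) ⟩
      sum (tabulate (λ w → b2n (p w) * F w + b2n (q w) * F w))
        ≡⟨ sum-tabulate-+ (λ w → b2n (p w) * F w) (λ w → b2n (q w) * F w) ⟩
      sum (tabulate (λ w → b2n (p w) * F w)) + sum (tabulate (λ w → b2n (q w) * F w))
        ≡⟨ cong₂ _+_ (sum-indicator (shift i d) p F (fromWitness refl) (λ w → sym ∘ toWitness))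
                     (sum-indicator (shift i (N ∸ d)) q F (fromWitness (shift-back i d≤N))
                                    (λ w → shift-solve d≤N ∘ toWitness)) ⟩
      F (shift i d) + F (shift i (N ∸ d)) ∎
      where
      open ≡-Reasoning
      p q : Fin N → Bool
      p w = ⌊ shift i d ≟ᶠ w ⌋
      q w = ⌊ shift w d ≟ᶠ i ⌋
      d≤N : d ≤ N
      d≤N = ≤-trans (m≤m+n d d) (<⇒≤ 2d<N)
      not-both : ∀ w → T (p w) → T (q w) → ⊥
      not-both w pw qw = <⇒≢ 0<d+d (sym (trans (sym (m<n⇒m%n≡m 2d<N)) (shift-trivial⁻¹ i round-trip)))
        where
        0<d+d : 0 < d + d
        0<d+d = ≤-trans 0<d (m≤m+n d d)
        round-trip : shift i (d + d) ≡ i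
        round-trip = trans (sym (shift-shift i d d))
          (trans (cong (λ x → shift x d) (toWitness pw)) (toWitness qw))

  numWalks-inner : ∀ L (i : Fin N) z → numWalks (suc L) (inner i) z ≡
    numWalks L (outer i) z + (numWalks L (inner (shift i 2)) z + numWalks L (inner (shift i (N ∸ 2))) z)
  numWalks-inner L i z = trans (sum-vertices (λ w → b2n (adj (inner i) w) * numWalks L w z)) (cong₂ _+_
    (sum-indicator i (λ w → ⌊ w ≟ᶠ i ⌋) (λ w → numWalks L (outer w) z) (fromWitness refl) (λ w → toWitness))
    (both-ways 2 (s≤s z≤n) N≥5 i (λ w → numWalks L (inner w) z)))

  numWalks-outer : ∀ L (i : Fin N) z → numWalks (suc L) (outer i) z ≡
    numWalks L (inner i) z + (numWalks L (outer (shift i 1)) z + numWalks L (outer (shift i (N ∸ 1))) z)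
  numWalks-outer L i z = trans (sum-vertices G) (trans (+-comm (sum (tabulate (G ∘ outer))) _) (cong₂ _+_
    (sum-indicator i (λ w → ⌊ i ≟ᶠ w ⌋ ∨ false) (λ w → numWalks L (inner w) z)
      (subst T (sym (∨-identityʳ _)) (fromWitness refl))
      (λ w → sym ∘ toWitness ∘ subst T (∨-identityʳ _)))
    (both-ways 1 (s≤s z≤n) (≤-trans (s≤s (s≤s (s≤s z≤n))) N≥5) i (λ w → numWalks L (outer w) z))))
    where
    G : Vtx N → ℕ
    G w = b2n (adj (outer i) w) * numWalks L w z

-- dᵢ p and dₒ p are the distances from v_p and u_p to v_0 in GP(ℤ,2): an odd index shift
-- forces a detour u u′ through the outer cycle.
dᵢ dₒ : ℕ → ℕ
dᵢ 0 = 0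
dᵢ 1 = 3
dᵢ (suc (suc p)) = suc (dᵢ p)
dₒ 0 = 1
dₒ 1 = 2
dₒ (suc (suc p)) = suc (dₒ p)

dᵢ-step : ∀ p → dᵢ p ≈₁ dᵢ (2 + p)
dᵢ-step p = ≤-trans (n≤1+n _) (n≤1+n _) , ≤-refl

dₒ-step : ∀ p → dₒ p ≈₁ dₒ (1 + p)
dₒ-step 0 = s≤s z≤n , ≤-refl
dₒ-step 1 = n≤1+n _ , n≤1+n _
dₒ-step (suc (suc p)) = let (≤₁ , ≤₂) = dₒ-step p in s≤s ≤₁ , s≤s ≤₂

dᵢ≈dₒ : ∀ p → dᵢ p ≈₁ dₒ p
dᵢ≈dₒ 0 = z≤n , s≤s z≤n
dᵢ≈dₒ 1 = ≤-refl , ≤-trans (n≤1+n _) (n≤1+n _)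
dᵢ≈dₒ (suc (suc p)) = let (≤₁ , ≤₂) = dᵢ≈dₒ p in s≤s ≤₁ , s≤s ≤₂

dᵢ-even : ∀ a → dᵢ (2 * a) ≡ a
dᵢ-even zero = refl
dᵢ-even (suc a) = trans (cong dᵢ (*-suc 2 a)) (cong suc (dᵢ-even a))

dᵢ-odd : ∀ a → dᵢ (1 + 2 * a) ≡ 3 + a
dᵢ-odd zero = refl
dᵢ-odd (suc a) = trans (cong (dᵢ ∘ suc) (*-suc 2 a)) (cong suc (dᵢ-odd a))

dₒ-even : ∀ a → dₒ (2 * a) ≡ 1 + a
dₒ-even zero = refl
dₒ-even (suc a) = trans (cong dₒ (*-suc 2 a)) (cong suc (dₒ-even a))

dₒ-odd : ∀ a → dₒ (1 + 2 * a) ≡ 2 + a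
dₒ-odd zero = refl
dₒ-odd (suc a) = trans (cong (dₒ ∘ suc) (*-suc 2 a)) (cong suc (dₒ-odd a))

module Offsets (M : ℕ) (M≥4 : 4 ≤ M) (j : Fin (suc M)) where

  open Cycle M
  open Neighbourhood M M≥4

  Wᵢ Wₒ : ℕ → ℕ → ℕ
  Wᵢ L t = numWalks L (inner (shift j t)) (inner j)
  Wₒ L t = numWalks L (outer (shift j t)) (inner j)

  1≤M : 1 ≤ M
  1≤M = ≤-trans (s≤s z≤n) M≥4

  Wᵢ-cong : ∀ L {a b} → a % N ≡ b % N → Wᵢ L a ≡ Wᵢ L b
  Wᵢ-cong L a≡b = cong (λ x → numWalks L (inner x) (inner j)) (shift-cong j a≡b)

  Wₒ-cong : ∀ L {a b} → a % N ≡ b % N → Wₒ L a ≡ Wₒ L b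
  Wₒ-cong L a≡b = cong (λ x → numWalks L (outer x) (inner j)) (shift-cong j a≡b)

  back-and-forth : ∀ {δ} t → δ ≤ N → (N ∸ δ + (δ + t)) % N ≡ t % N
  back-and-forth {δ} t δ≤N =
    trans (cong (_% N) (trans (sym (+-assoc (N ∸ δ) δ t)) (cong (_+ t) (m∸n+n≡m δ≤N))))
    (%-remove-+ˡ t (∣-refl {N}))

  Wᵢ-zero : ∀ t → Wᵢ 0 t ≡ b2n ⌊ t % N ≟ 0 ⌋
  Wᵢ-zero t = cong b2n (⌊⌋-⇔ (mk⇔ (shift-trivial⁻¹ j) (shift-trivial j)) (shift j t ≟ᶠ j) (t % N ≟ 0))

  shift-offset : ∀ t δ → shift (shift j t) δ ≡ shift j (δ + t)
  shift-offset t δ = trans (shift-shift j t δ) (cong (shift j) (+-comm t δ))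

  Wᵢ-suc : ∀ L t → Wᵢ (suc L) t ≡ Wₒ L t + (Wᵢ L (2 + t) + Wᵢ L (N ∸ 2 + t))
  Wᵢ-suc L t = trans (numWalks-inner L (shift j t) (inner j))
    (cong₂ (λ x y → Wₒ L t + (numWalks L (inner x) (inner j) + numWalks L (inner y) (inner j)))
      (shift-offset t 2) (shift-offset t (N ∸ 2)))

  Wₒ-suc : ∀ L t → Wₒ (suc L) t ≡ Wᵢ L t + (Wₒ L (1 + t) + Wₒ L (N ∸ 1 + t))
  Wₒ-suc L t = trans (numWalks-outer L (shift j t) (inner j))
    (cong₂ (λ x y → Wᵢ L t + (numWalks L (outer x) (inner j) + numWalks L (outer y) (inner j)))
      (shift-offset t 1) (shift-offset t (N ∸ 1)))

  2≤N : 2 ≤ N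
  2≤N = s≤s 1≤M

  opposite-steps : ∀ a b {δ} → (a + b) % N ≡ 0 → δ ≤ N → ((δ + a) + (N ∸ δ + b)) % N ≡ 0
  opposite-steps a b {δ} a+b≡0 δ≤N = begin
    ((δ + a) + (N ∸ δ + b)) % N   ≡⟨ cong (_% N) (interchange +-commutativeSemigroup δ a (N ∸ δ) b) ⟩
    ((δ + (N ∸ δ)) + (a + b)) % N ≡⟨ cong (λ x → (x + (a + b)) % N) (m+[n∸m]≡n δ≤N) ⟩
    (N + (a + b)) % N             ≡⟨ %-remove-+ˡ (a + b) (∣-refl {N}) ⟩
    (a + b) % N                   ≡⟨ a+b≡0 ⟩
    0                             ∎
    where open ≡-Reasoning

  opposite-steps′ : ∀ a b {δ} → (a + b) % N ≡ 0 → δ ≤ N → ((N ∸ δ + a) + (δ + b)) % N ≡ 0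
  opposite-steps′ a b {δ} a+b≡0 δ≤N = trans (cong (_% N) (+-comm (N ∸ δ + a) (δ + b)))
    (opposite-steps b a (trans (cong (_% N) (+-comm b a)) a+b≡0) δ≤N)

  %≡0-+ : ∀ a b → a % N ≡ 0 → (a + b) % N ≡ b % N
  %≡0-+ a b a≡0 = trans (sym (%-absorbˡ a b)) (cong (λ x → (x + b) % N) a≡0)

  reflectionᵢ : ∀ L {a b} → (a + b) % N ≡ 0 → Wᵢ L a ≡ Wᵢ L b
  reflectionₒ : ∀ L {a b} → (a + b) % N ≡ 0 → Wₒ L a ≡ Wₒ L b

  reflectionᵢ zero {a} {b} a+b≡0 = begin
    Wᵢ 0 a                 ≡⟨ Wᵢ-zero a ⟩
    b2n ⌊ a % N ≟ 0 ⌋      ≡⟨ cong b2n (⌊⌋-⇔ (mk⇔ a⇒b b⇒a) (a % N ≟ 0) (b % N ≟ 0)) ⟩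
    b2n ⌊ b % N ≟ 0 ⌋      ≡⟨ Wᵢ-zero b ⟨
    Wᵢ 0 b                 ∎
    where
    open ≡-Reasoning
    a⇒b : a % N ≡ 0 → b % N ≡ 0
    a⇒b a≡0 = trans (sym (%≡0-+ a b a≡0)) a+b≡0
    b⇒a : b % N ≡ 0 → a % N ≡ 0
    b⇒a b≡0 = trans (sym (%≡0-+ b a b≡0)) (trans (cong (_% N) (+-comm b a)) a+b≡0)
  reflectionᵢ (suc L) {a} {b} a+b≡0 = begin
    Wᵢ (suc L) a                                  ≡⟨ Wᵢ-suc L a ⟩
    Wₒ L a + (Wᵢ L (2 + a) + Wᵢ L (N ∸ 2 + a))
      ≡⟨ cong₂ _+_ (reflectionₒ L a+b≡0)
           (cong₂ _+_ (reflectionᵢ L {2 + a} (opposite-steps a b a+b≡0 2≤N))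
                      (reflectionᵢ L {N ∸ 2 + a} (opposite-steps′ a b a+b≡0 2≤N))) ⟩
    Wₒ L b + (Wᵢ L (N ∸ 2 + b) + Wᵢ L (2 + b))    ≡⟨ cong (Wₒ L b +_) (+-comm (Wᵢ L (N ∸ 2 + b)) _) ⟩
    Wₒ L b + (Wᵢ L (2 + b) + Wᵢ L (N ∸ 2 + b))    ≡⟨ Wᵢ-suc L b ⟨
    Wᵢ (suc L) b                                  ∎
    where open ≡-Reasoning

  reflectionₒ zero a+b≡0 = refl
  reflectionₒ (suc L) {a} {b} a+b≡0 = begin
    Wₒ (suc L) a                                  ≡⟨ Wₒ-suc L a ⟩
    Wᵢ L a + (Wₒ L (1 + a) + Wₒ L (N ∸ 1 + a))
      ≡⟨ cong₂ _+_ (reflectionᵢ L a+b≡0)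
           (cong₂ _+_ (reflectionₒ L {1 + a} (opposite-steps a b a+b≡0 1≤N))
                      (reflectionₒ L {N ∸ 1 + a} (opposite-steps′ a b a+b≡0 1≤N))) ⟩
    Wᵢ L b + (Wₒ L (N ∸ 1 + b) + Wₒ L (1 + b))    ≡⟨ cong (Wᵢ L b +_) (+-comm (Wₒ L (N ∸ 1 + b)) _) ⟩
    Wᵢ L b + (Wₒ L (1 + b) + Wₒ L (N ∸ 1 + b))    ≡⟨ Wₒ-suc L b ⟨
    Wₒ (suc L) b                                  ∎
    where
    open ≡-Reasoning
    1≤N : 1 ≤ N
    1≤N = s≤s z≤n

  φᵢ φₒ : ℕ → ℕ
  φᵢ = cyclic dᵢ
  φₒ = cyclic dₒ

  Wᵢ-below : ∀ L t → L < φᵢ t → Wᵢ L t ≡ 0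
  Wₒ-below : ∀ L t → L < φₒ t → Wₒ L t ≡ 0

  Wᵢ-below zero t 0<φᵢt =
    trans (Wᵢ-zero t) (cong b2n (trans (isYes≗does (t % N ≟ 0)) (dec-false (t % N ≟ 0) t≢0)))
    where
    t≢0 : t % N ≢ 0
    t≢0 t≡0 = <⇒≢ 0<φᵢt (sym (cong (around dᵢ) t≡0))
  Wᵢ-below (suc L) t L<φᵢt = begin
    Wᵢ (suc L) t                                ≡⟨ Wᵢ-suc L t ⟩
    Wₒ L t + (Wᵢ L (2 + t) + Wᵢ L (N ∸ 2 + t))
      ≡⟨ cong₂ _+_ (Wₒ-below L t (below (proj₁ (cyclic-≈₁ dᵢ≈dₒ t))))
      (cong₂ _+_ (Wᵢ-below L (2 + t) (below (proj₁ (cyclic-step 1≤M ≤-refl dᵢ-step t))))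
                 (Wᵢ-below L (N ∸ 2 + t) (below (proj₁ (cyclic-step-back 1≤M ≤-refl dᵢ-step t))))) ⟩
    0                                           ∎
    where
    open ≡-Reasoning
    below : ∀ {x} → φᵢ t ≤ suc x → L < x
    below φᵢt≤1+x = ≤-pred (≤-trans L<φᵢt φᵢt≤1+x)

  Wₒ-below zero t _ = refl
  Wₒ-below (suc L) t L<φₒt = begin
    Wₒ (suc L) t                                ≡⟨ Wₒ-suc L t ⟩
    Wᵢ L t + (Wₒ L (1 + t) + Wₒ L (N ∸ 1 + t))
      ≡⟨ cong₂ _+_ (Wᵢ-below L t (below (proj₂ (cyclic-≈₁ dᵢ≈dₒ t))))
      (cong₂ _+_ (Wₒ-below L (1 + t) (below (proj₁ (cyclic-step 1≤M (s≤s z≤n) dₒ-step t))))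
                 (Wₒ-below L (N ∸ 1 + t) (below (proj₁ (cyclic-step-back 1≤M (s≤s z≤n) dₒ-step t))))) ⟩
    0                                           ∎
    where
    open ≡-Reasoning
    below : ∀ {x} → φₒ t ≤ suc x → L < x
    below φₒt≤1+x = ≤-pred (≤-trans L<φₒt φₒt≤1+x)

  Offset : Fin N → ℕ → Set
  Offset i t = ∀ L → numWalks L (inner i) (inner j) ≡ Wᵢ L t

  Offset-reflect : ∀ {i t u} → (t + u) % N ≡ 0 → Offset i t → Offset i u
  Offset-reflect t+u≡0 off L = trans (off L) (reflectionᵢ L t+u≡0)

  offset-∣-∣ : ∀ i → Offset i ∣ toℕ i - toℕ j ∣
  offset-∣-∣ i with ≤-total (toℕ j) (toℕ i)
  ... | inj₁ j≤i = λ L → cong (λ x → numWalks L (inner x) (inner j)) (sym j+r≡i)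
    where
    j+r≡i : shift j ∣ toℕ i - toℕ j ∣ ≡ i
    j+r≡i = toℕ-injective (begin
      toℕ (shift j ∣ toℕ i - toℕ j ∣)        ≡⟨ toℕ-shift j _ ⟩
      (toℕ j + ∣ toℕ i - toℕ j ∣) % N        ≡⟨ cong (λ x → (toℕ j + x) % N) (m≤n⇒∣n-m∣≡n∸m j≤i) ⟩
      (toℕ j + (toℕ i ∸ toℕ j)) % N          ≡⟨ cong (_% N) (m+[n∸m]≡n j≤i) ⟩
      toℕ i % N                              ≡⟨ m<n⇒m%n≡m (toℕ<n i) ⟩
      toℕ i                                  ∎)
      where open ≡-Reasoning
  ... | inj₂ i≤j = Offset-reflect (trans (cong (_% N) (m∸n+n≡m r≤N)) (n%n≡0 N))
                     (λ L → cong (λ x → numWalks L (inner x) (inner j)) (sym j-r≡i))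
    where
    r : ℕ
    r = ∣ toℕ i - toℕ j ∣
    r≡j∸i : r ≡ toℕ j ∸ toℕ i
    r≡j∸i = m≤n⇒∣m-n∣≡n∸m i≤j
    r≤N : r ≤ N
    r≤N = ≤-trans (≤-reflexive r≡j∸i) (≤-trans (m∸n≤m (toℕ j) (toℕ i)) (<⇒≤ (toℕ<n j)))
    j-r≡i : shift j (N ∸ r) ≡ i
    j-r≡i = toℕ-injective (begin
      toℕ (shift j (N ∸ r))          ≡⟨ toℕ-shift j (N ∸ r) ⟩
      (toℕ j + (N ∸ r)) % N          ≡⟨ cong (λ x → (x + (N ∸ r)) % N) j≡i+r ⟩
      (toℕ i + r + (N ∸ r)) % N      ≡⟨ cong (_% N) (+-assoc (toℕ i) r (N ∸ r)) ⟩
      (toℕ i + (r + (N ∸ r))) % N    ≡⟨ cong (λ x → (toℕ i + x) % N) (m+[n∸m]≡n r≤N) ⟩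
      (toℕ i + N) % N                ≡⟨ [m+n]%n≡m%n (toℕ i) N ⟩
      toℕ i % N                      ≡⟨ m<n⇒m%n≡m (toℕ<n i) ⟩
      toℕ i                          ∎)
      where
      open ≡-Reasoning
      j≡i+r : toℕ j ≡ toℕ i + r
      j≡i+r = trans (sym (m+[n∸m]≡n i≤j)) (cong (toℕ i +_) (sym r≡j∸i))

even-split : ∀ {r k} → r % 2 ≡ 0 → r ≤ k → ∃₂ λ a c → r ≡ 2 * a × a + c ≡ k × a ≤ c
even-split {r} {k} r%2≡0 r≤k = a , k ∸ a , r≡2a , m+[n∸m]≡n a≤k , a≤k∸a
  where
  a : ℕ
  a = r / 2
  r≡2a : r ≡ 2 * a
  r≡2a = trans (m≡m%n+[m/n]*n r 2) (trans (cong (_+ a * 2) r%2≡0) (*-comm a 2))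
  2a≤k : 2 * a ≤ k
  2a≤k = subst (_≤ k) r≡2a r≤k
  a≤k : a ≤ k
  a≤k = ≤-trans (m≤m+n a (a + 0)) 2a≤k
  a≤k∸a : a ≤ k ∸ a
  a≤k∸a = subst (_≤ k ∸ a) (+-identityʳ a)
    (+-cancelˡ-≤ a (a + 0) (k ∸ a) (subst (2 * a ≤_) (sym (m+[n∸m]≡n a≤k)) 2a≤k))

odd-split : ∀ {r k} → r % 2 ≡ 1 → r ≤ k → ∃₂ λ a c → r ≡ 1 + 2 * a × a + c ≡ k
odd-split {r} {k} r%2≡1 r≤k = a , k ∸ a , r≡1+2a , m+[n∸m]≡n a≤k
  where
  a : ℕ
  a = r / 2
  r≡1+2a : r ≡ 1 + 2 * a
  r≡1+2a = trans (m≡m%n+[m/n]*n r 2) (trans (cong (_+ a * 2) r%2≡1) (cong suc (*-comm a 2)))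
  a≤k : a ≤ k
  a≤k = ≤-trans (≤-trans (m≤m+n a (a + 0)) (n≤1+n _)) (subst (_≤ k) r≡1+2a r≤k)

odd-above : ∀ {a c k} → a + c ≡ k → k ∸ 2 < 1 + 2 * a → c ≤ 2 + a
odd-above {a} {c} refl k∸2<1+2a = +-cancelˡ-≤ a c (2 + a) (begin
  a + c               ≤⟨ m≤n+m∸n (a + c) 2 ⟩
  2 + (a + c ∸ 2)     ≤⟨ +-monoʳ-≤ 2 (≤-pred k∸2<1+2a) ⟩
  2 + 2 * a           ≡⟨ regroup a ⟩
  a + (2 + a)         ∎)
  where
  open ≤-Reasoning
  regroup : ∀ a → 2 + 2 * a ≡ a + (2 + a)
  regroup = solve-∀

odd-below : ∀ {a c k} → a + c ≡ k → 2 ≤ k → 1 + 2 * a < k ∸ 2 → 4 + a ≤ c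
odd-below {a} {c} refl 2≤k 1+2a<k∸2 = +-cancelˡ-≤ a (4 + a) c (begin
  a + (4 + a)         ≡⟨ regroup a ⟩
  2 + (2 + 2 * a)     ≤⟨ +-monoʳ-≤ 2 1+2a<k∸2 ⟩
  2 + (a + c ∸ 2)     ≡⟨ m+[n∸m]≡n 2≤k ⟩
  a + c               ∎)
  where
  open ≤-Reasoning
  regroup : ∀ a → a + (4 + a) ≡ 2 + (2 + 2 * a)
  regroup = solve-∀

odd-at : ∀ {a c k} → a + c ≡ k → 2 ≤ k → 1 + 2 * a ≡ k ∸ 2 → c ≡ 3 + a
odd-at {a} {c} refl 2≤k 1+2a≡k∸2 = +-cancelˡ-≡ a c (3 + a) (begin
  a + c               ≡⟨ m+[n∸m]≡n 2≤k ⟨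
  2 + (a + c ∸ 2)     ≡⟨ cong (2 +_) 1+2a≡k∸2 ⟨
  2 + (1 + 2 * a)     ≡⟨ regroup a ⟩
  a + (3 + a)         ∎)
  where
  open ≡-Reasoning
  regroup : ∀ a → 2 + (1 + 2 * a) ≡ a + (3 + a)
  regroup = solve-∀

half-odd+1 : ∀ a → (1 + 2 * a + 1) / 2 ≡ 1 + a
half-odd+1 a = trans (cong (_/ 2) (double a)) (m*n/n≡m (1 + a) 2)
  where
  double : ∀ a → 1 + 2 * a + 1 ≡ (1 + a) * 2
  double = solve-∀

half-odd+3 : ∀ a → (1 + 2 * a + 3) / 2 ≡ 2 + a
half-odd+3 a = trans (cong (_/ 2) (double a)) (m*n/n≡m (2 + a) 2)
  where
  double : ∀ a → 1 + 2 * a + 3 ≡ (2 + a) * 2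
  double = solve-∀

σ-Formula : ℕ → ℕ → ℕ → Set
σ-Formula k r s =
    (r % 2 ≡ 0 → s ≡ 1)
  × (r % 2 ≡ 1 → r > k ∸ 2 → s ≡ 1)
  × (r % 2 ≡ 1 → r < k ∸ 2 → s ≡ (r + 1) / 2)
  × (r % 2 ≡ 1 → r ≡ k ∸ 2 → s ≡ (r + 3) / 2)

module OddOrder (k : ℕ) (k≥3 : 3 ≤ k) (j : Fin (suc (2 * k))) where

  open Cycle (2 * k)
  open Offsets (2 * k) (*-monoʳ-≤ 2 (≤-trans (n≤1+n 2) k≥3)) j

  module _ (a c : ℕ) (a+c≡k : a + c ≡ k) where

    1+2a≤N : 1 + 2 * a ≤ N
    1+2a≤N = s≤s (*-monoʳ-≤ 2 (subst (a ≤_) a+c≡k (m≤m+n a c)))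

    N∸2a : N ∸ 2 * a ≡ 1 + 2 * c
    N∸2a = begin
      suc (2 * k) ∸ 2 * a           ≡⟨ cong (λ x → suc (2 * x) ∸ 2 * a) a+c≡k ⟨
      suc (2 * (a + c)) ∸ 2 * a     ≡⟨ cong (λ x → suc x ∸ 2 * a) (*-distribˡ-+ 2 a c) ⟩
      suc (2 * a + 2 * c) ∸ 2 * a   ≡⟨ cong (_∸ 2 * a) (+-suc (2 * a) (2 * c)) ⟨
      2 * a + suc (2 * c) ∸ 2 * a   ≡⟨ m+n∸m≡n (2 * a) _ ⟩
      1 + 2 * c                     ∎
      where open ≡-Reasoning

    N∸1+2a : N ∸ (1 + 2 * a) ≡ 2 * c
    N∸1+2a = begin
      2 * k ∸ 2 * a             ≡⟨ cong (λ x → 2 * x ∸ 2 * a) a+c≡k ⟨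
      2 * (a + c) ∸ 2 * a       ≡⟨ cong (_∸ 2 * a) (*-distribˡ-+ 2 a c) ⟩
      2 * a + 2 * c ∸ 2 * a     ≡⟨ m+n∸m≡n (2 * a) _ ⟩
      2 * c                     ∎
      where open ≡-Reasoning

    φᵢ-even : φᵢ (2 * a) ≡ a ⊓ (3 + c)
    φᵢ-even = trans (cyclic-≤N dᵢ (≤-trans (n≤1+n _) 1+2a≤N))
      (cong₂ _⊓_ (dᵢ-even a) (trans (cong dᵢ N∸2a) (dᵢ-odd c)))

    φᵢ-odd : φᵢ (1 + 2 * a) ≡ (3 + a) ⊓ c
    φᵢ-odd = trans (cyclic-≤N dᵢ 1+2a≤N)
      (cong₂ _⊓_ (dᵢ-odd a) (trans (cong dᵢ N∸1+2a) (dᵢ-even c)))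

    φₒ-even : φₒ (2 * a) ≡ (1 + a) ⊓ (2 + c)
    φₒ-even = trans (cyclic-≤N dₒ (≤-trans (n≤1+n _) 1+2a≤N))
      (cong₂ _⊓_ (dₒ-even a) (trans (cong dₒ N∸2a) (dₒ-odd c)))

    φₒ-odd : φₒ (1 + 2 * a) ≡ (2 + a) ⊓ (1 + c)
    φₒ-odd = trans (cyclic-≤N dₒ 1+2a≤N)
      (cong₂ _⊓_ (dₒ-odd a) (trans (cong dₒ N∸1+2a) (dₒ-even c)))

  vanishᵢ : ∀ {L t x} → φᵢ t ≡ x → L < x → Wᵢ L t ≡ 0
  vanishᵢ {L} {t} φᵢt≡x L<x = Wᵢ-below L t (subst (L <_) (sym φᵢt≡x) L<x)

  vanishₒ : ∀ {L t x} → φₒ t ≡ x → L < x → Wₒ L t ≡ 0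
  vanishₒ {L} {t} φₒt≡x L<x = Wₒ-below L t (subst (L <_) (sym φₒt≡x) L<x)

  Wᵢ-unwind : ∀ L {δ} x → δ ≤ N → Wᵢ L (N ∸ δ + (δ + x)) ≡ Wᵢ L x
  Wᵢ-unwind L x δ≤N = Wᵢ-cong L (back-and-forth x δ≤N)

  Wₒ-unwind : ∀ L {δ} x → δ ≤ N → Wₒ L (N ∸ δ + (δ + x)) ≡ Wₒ L x
  Wₒ-unwind L x δ≤N = Wₒ-cong L (back-and-forth x δ≤N)

  Wᵢ-even : ∀ a c → a + c ≡ k → a ≤ 2 + c → Wᵢ a (2 * a) ≡ 1
  Wᵢ-even zero _ _ _ = Wᵢ-zero 0
  Wᵢ-even (suc a) zero a+c≡k a<2 =
    contradiction (subst (_≤ 2) (trans (sym (+-identityʳ _)) a+c≡k) a<2) (<⇒≱ k≥3)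
  Wᵢ-even (suc a) (suc c) a+c≡k a<3+c = begin
    Wᵢ (suc a) (2 * suc a)
      ≡⟨ cong (Wᵢ (suc a)) (*-suc 2 a) ⟩
    Wᵢ (suc a) (2 + 2 * a)
      ≡⟨ Wᵢ-suc a (2 + 2 * a) ⟩
    Wₒ a (2 + 2 * a) + (Wᵢ a (2 + (2 + 2 * a)) + Wᵢ a (N ∸ 2 + (2 + 2 * a)))
      ≡⟨ cong₂ _+_ spoke (cong₂ _+_ ahead behind) ⟩
    1 ∎
    where
    open ≡-Reasoning
    spoke : Wₒ a (2 + 2 * a) ≡ 0
    spoke = vanishₒ (trans (cong φₒ (sym (*-suc 2 a))) (φₒ-even (suc a) (suc c) a+c≡k))
                    (⊓-glb (s≤s (n≤1+n a)) a<3+c)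
    ahead : Wᵢ a (2 + (2 + 2 * a)) ≡ 0
    ahead = vanishᵢ (trans (cong φᵢ (sym (trans (*-suc 2 (suc a)) (cong (2 +_) (*-suc 2 a)))))
                           (φᵢ-even (2 + a) c (trans (sym (+-suc (suc a) c)) a+c≡k)))
                    (⊓-glb (s≤s (n≤1+n a)) a<3+c)
    behind : Wᵢ a (N ∸ 2 + (2 + 2 * a)) ≡ 1
    behind = trans (Wᵢ-unwind a (2 * a) 2≤N)
      (Wᵢ-even a (suc (suc c)) (trans (+-suc a (suc c)) a+c≡k) (≤-trans (<⇒≤ a<3+c) (n≤1+n _)))

  Wₒ-even : ∀ a c → a + c ≡ k → a ≤ c → Wₒ (suc a) (2 * a) ≡ 1
  Wₒ-even a c a+c≡k a≤c = begin
    Wₒ (suc a) (2 * a)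
      ≡⟨ Wₒ-suc a (2 * a) ⟩
    Wᵢ a (2 * a) + (Wₒ a (1 + 2 * a) + Wₒ a (N ∸ 1 + 2 * a))
      ≡⟨ cong₂ _+_ (Wᵢ-even a c a+c≡k (≤-trans a≤c (m≤n+m c 2))) (cong₂ _+_ ahead (behind a c a+c≡k a≤c)) ⟩
    1 ∎
    where
    open ≡-Reasoning
    ahead : Wₒ a (1 + 2 * a) ≡ 0
    ahead = vanishₒ (φₒ-odd a c a+c≡k) (⊓-glb (s≤s (n≤1+n a)) (s≤s a≤c))
    behind : ∀ a c → a + c ≡ k → a ≤ c → Wₒ a (N ∸ 1 + 2 * a) ≡ 0
    behind zero _ _ _ = refl
    behind (suc a) c a+c≡k a<c = trans (cong (λ x → Wₒ (suc a) (N ∸ 1 + x)) (*-suc 2 a))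
      (trans (Wₒ-unwind (suc a) (1 + 2 * a) (s≤s z≤n))
        (vanishₒ (φₒ-odd a (suc c) (trans (+-suc a c) a+c≡k))
                 (⊓-glb (n<1+n _) (s≤s (≤-trans a<c (n≤1+n c))))))

  Wₒ-odd : ∀ a c → a + c ≡ k → 2 + a ≤ c → Wₒ (2 + a) (1 + 2 * a) ≡ 1
  Wₒ-odd a (suc c) a+c≡k 2+a≤c = begin
    Wₒ (2 + a) (1 + 2 * a)
      ≡⟨ Wₒ-suc (1 + a) (1 + 2 * a) ⟩
    Wᵢ (1 + a) (1 + 2 * a) + (Wₒ (1 + a) (2 + 2 * a) + Wₒ (1 + a) (N ∸ 1 + (1 + 2 * a)))
      ≡⟨ cong₂ _+_ spoke (cong₂ _+_ ahead behind) ⟩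
    1 ∎
    where
    open ≡-Reasoning
    a≤c : a ≤ c
    a≤c = ≤-pred (≤-trans (n≤1+n _) 2+a≤c)
    spoke : Wᵢ (1 + a) (1 + 2 * a) ≡ 0
    spoke = vanishᵢ (φᵢ-odd a (suc c) a+c≡k) (⊓-glb (s≤s (s≤s (n≤1+n a))) 2+a≤c)
    ahead : Wₒ (1 + a) (2 + 2 * a) ≡ 0
    ahead = vanishₒ (trans (cong φₒ (sym (*-suc 2 a))) (φₒ-even (suc a) c (trans (sym (+-suc a c)) a+c≡k)))
                    (⊓-glb ≤-refl (s≤s (s≤s a≤c)))
    behind : Wₒ (1 + a) (N ∸ 1 + (1 + 2 * a)) ≡ 1
    behind = trans (Wₒ-unwind (1 + a) (2 * a) (s≤s z≤n))
      (Wₒ-even a (suc c) a+c≡k (≤-trans a≤c (n≤1+n c)))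

  Wᵢ-far : ∀ a c → a + c ≡ k → 4 + a ≤ c → Wᵢ (2 + a) (3 + 2 * a) ≡ 0
  Wᵢ-far a (suc c) a+c≡k 4+a≤c =
    vanishᵢ (trans (cong (φᵢ ∘ suc) (sym (*-suc 2 a))) (φᵢ-odd (suc a) c (trans (sym (+-suc a c)) a+c≡k)))
            (⊓-glb (s≤s (s≤s (s≤s (n≤1+n a)))) (≤-pred 4+a≤c))

  -- The last term counts the geodesics whose first inner step goes away from v_j, round the
  -- far side of the cycle (see Wᵢ-far and Wᵢ-tight).
  Wᵢ-odd : ∀ a c → a + c ≡ k → 3 + a ≤ c → Wᵢ (3 + a) (1 + 2 * a) ≡ suc a + Wᵢ (2 + a) (3 + 2 * a)
  Wᵢ-odd-behind : ∀ a c → a + c ≡ k → 3 + a ≤ c → Wᵢ (2 + a) (N ∸ 2 + (1 + 2 * a)) ≡ a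

  Wᵢ-odd a c a+c≡k 3+a≤c = begin
    Wᵢ (3 + a) (1 + 2 * a)
      ≡⟨ Wᵢ-suc (2 + a) (1 + 2 * a) ⟩
    Wₒ (2 + a) (1 + 2 * a) + (Wᵢ (2 + a) (3 + 2 * a) + Wᵢ (2 + a) (N ∸ 2 + (1 + 2 * a)))
      ≡⟨ cong₂ _+_ (Wₒ-odd a c a+c≡k (≤-trans (n≤1+n _) 3+a≤c))
                   (cong (Wᵢ (2 + a) (3 + 2 * a) +_) (Wᵢ-odd-behind a c a+c≡k 3+a≤c)) ⟩
    1 + (Wᵢ (2 + a) (3 + 2 * a) + a)
      ≡⟨ cong suc (+-comm _ a) ⟩
    suc a + Wᵢ (2 + a) (3 + 2 * a) ∎
    where open ≡-Reasoning

  Wᵢ-odd-behind zero c c≡k _ =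
    trans (cong (Wᵢ 2) (m∸n+n≡m {2 * k} {1} (≤-trans (≤-trans (s≤s z≤n) k≥3) k≤2k)))
          (vanishᵢ (φᵢ-even k 0 (+-identityʳ k)) (⊓-glb k≥3 ≤-refl))
    where
    k≤2k : k ≤ 2 * k
    k≤2k = m≤m+n k (k + 0)
  Wᵢ-odd-behind (suc a) c a+c≡k 3+a≤c = begin
    Wᵢ (3 + a) (N ∸ 2 + (1 + 2 * suc a))  ≡⟨ cong (λ x → Wᵢ (3 + a) (N ∸ 2 + suc x)) (*-suc 2 a) ⟩
    Wᵢ (3 + a) (N ∸ 2 + (2 + (1 + 2 * a))) ≡⟨ Wᵢ-unwind (3 + a) (1 + 2 * a) 2≤N ⟩
    Wᵢ (3 + a) (1 + 2 * a)                 ≡⟨ Wᵢ-odd a (suc c) a+c≡k′ (≤-trans (n≤1+n _) 4+a≤1+c) ⟩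
    suc a + Wᵢ (2 + a) (3 + 2 * a)         ≡⟨ cong (suc a +_) (Wᵢ-far a (suc c) a+c≡k′ 4+a≤1+c) ⟩
    suc a + 0                              ≡⟨ +-identityʳ (suc a) ⟩
    suc a                                  ∎
    where
    open ≡-Reasoning
    a+c≡k′ : a + suc c ≡ k
    a+c≡k′ = trans (+-suc a c) a+c≡k
    4+a≤1+c : 4 + a ≤ suc c
    4+a≤1+c = ≤-trans 3+a≤c (n≤1+n c)

  Wᵢ-tight : ∀ a c → a + c ≡ k → c ≡ 3 + a → Wᵢ (2 + a) (3 + 2 * a) ≡ 1
  Wᵢ-tight a c a+c≡k refl = trans (reflectionᵢ (2 + a) opposite)
    (Wᵢ-even (2 + a) (suc a) (trans (regroup a) a+c≡k) (n≤1+n _))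
    where
    regroup : ∀ a → 2 + a + suc a ≡ a + (3 + a)
    regroup = solve-∀
    sum≡N : ∀ a → 3 + 2 * a + 2 * (2 + a) ≡ suc (2 * (a + (3 + a)))
    sum≡N = solve-∀
    opposite : (3 + 2 * a + 2 * (2 + a)) % N ≡ 0
    opposite = trans (cong (_% N) (trans (sum≡N a) (cong (λ x → suc (2 * x)) a+c≡k))) (n%n≡0 N)

  σ-at : ∀ {i t d m} → Offset i t → φᵢ t ≡ d → d ≤ k → Wᵢ d t ≡ suc m → σ (inner i) (inner j) ≡ suc m
  σ-at {i} {t} {d} off φᵢt≡d d≤k Wᵢdt≡1+m =
    trans (σ≡numWalks (inner i) (inner j) d d<N+N zeros positive) (trans (off d) Wᵢdt≡1+m)
    where
    d<N+N : d < N + N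
    d<N+N = ≤-trans (s≤s (≤-trans d≤k (m≤m+n k (k + 0)))) (m≤m+n N N)
    zeros : ∀ L → L < d → numWalks L (inner i) (inner j) ≡ 0
    zeros L L<d = trans (off L) (vanishᵢ φᵢt≡d L<d)
    positive : 0 < numWalks d (inner i) (inner j)
    positive = subst (0 <_) (sym (trans (off d) Wᵢdt≡1+m)) (s≤s z≤n)

  σ-even : ∀ {i} a c → a + c ≡ k → a ≤ 2 + c → Offset i (2 * a) → σ (inner i) (inner j) ≡ 1
  σ-even a c a+c≡k a≤2+c off =
    σ-at off (trans (φᵢ-even a c a+c≡k) (m≤n⇒m⊓n≡m (≤-trans a≤2+c (n≤1+n _))))
      (subst (a ≤_) a+c≡k (m≤m+n a c)) (Wᵢ-even a c a+c≡k a≤2+c)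

  σ-odd : ∀ {i} a c → a + c ≡ k → 3 + a ≤ c → Offset i (1 + 2 * a) →
    σ (inner i) (inner j) ≡ suc a + Wᵢ (2 + a) (3 + 2 * a)
  σ-odd a c a+c≡k 3+a≤c off =
    σ-at off (trans (φᵢ-odd a c a+c≡k) (m≤n⇒m⊓n≡m 3+a≤c))
      (≤-trans 3+a≤c (subst (c ≤_) a+c≡k (m≤n+m c a))) (Wᵢ-odd a c a+c≡k 3+a≤c)

  σ-formula : ∀ {i} r → Offset i r → r ≤ k → σ-Formula k r (σ (inner i) (inner j))
  σ-formula {i} r off r≤k = even , odd-far , odd-near , odd-tight
    where
    2≤k : 2 ≤ k
    2≤k = ≤-trans (n≤1+n 2) k≥3
    even : r % 2 ≡ 0 → σ (inner i) (inner j) ≡ 1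
    even r%2≡0 with even-split r%2≡0 r≤k
    ... | a , c , refl , a+c≡k , a≤c = σ-even a c a+c≡k (≤-trans a≤c (m≤n+m c 2)) off
    odd-far : r % 2 ≡ 1 → r > k ∸ 2 → σ (inner i) (inner j) ≡ 1
    odd-far r%2≡1 r>k∸2 with odd-split r%2≡1 r≤k
    ... | a , c , refl , a+c≡k =
      σ-even c a (trans (+-comm c a) a+c≡k) (odd-above a+c≡k r>k∸2) (Offset-reflect opposite off)
      where
      opposite : (1 + 2 * a + 2 * c) % N ≡ 0
      opposite = trans (cong (λ x → suc x % N) (trans (sym (*-distribˡ-+ 2 a c)) (cong (2 *_) a+c≡k)))
                       (n%n≡0 N)
    odd-near : r % 2 ≡ 1 → r < k ∸ 2 → σ (inner i) (inner j) ≡ (r + 1) / 2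
    odd-near r%2≡1 r<k∸2 with odd-split r%2≡1 r≤k
    ... | a , c , refl , a+c≡k = begin
      σ (inner i) (inner j)            ≡⟨ σ-odd a c a+c≡k (≤-trans (n≤1+n _) 4+a≤c) off ⟩
      suc a + Wᵢ (2 + a) (3 + 2 * a)   ≡⟨ cong (suc a +_) (Wᵢ-far a c a+c≡k 4+a≤c) ⟩
      suc a + 0                        ≡⟨ +-identityʳ (suc a) ⟩
      suc a                            ≡⟨ half-odd+1 a ⟨
      (1 + 2 * a + 1) / 2              ∎
      where
      open ≡-Reasoning
      4+a≤c : 4 + a ≤ c
      4+a≤c = odd-below a+c≡k 2≤k r<k∸2
    odd-tight : r % 2 ≡ 1 → r ≡ k ∸ 2 → σ (inner i) (inner j) ≡ (r + 3) / 2
    odd-tight r%2≡1 r≡k∸2 with odd-split r%2≡1 r≤k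
    ... | a , c , refl , a+c≡k = begin
      σ (inner i) (inner j)            ≡⟨ σ-odd a c a+c≡k (≤-reflexive (sym c≡3+a)) off ⟩
      suc a + Wᵢ (2 + a) (3 + 2 * a)   ≡⟨ cong (suc a +_) (Wᵢ-tight a c a+c≡k c≡3+a) ⟩
      suc a + 1                        ≡⟨ +-comm (suc a) 1 ⟩
      2 + a                            ≡⟨ half-odd+3 a ⟨
      (1 + 2 * a + 3) / 2              ∎
      where
      open ≡-Reasoning
      c≡3+a : c ≡ 3 + a
      c≡3+a = odd-at a+c≡k 2≤k r≡k∸2

  σ-inner : ∀ i → ∣ toℕ i - toℕ j ∣ ≤ k → σ-Formula k ∣ toℕ i - toℕ j ∣ (σ (inner i) (inner j))
  σ-inner i = σ-formula ∣ toℕ i - toℕ j ∣ (offset-∣-∣ i)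

-- GP(5,2) is the Petersen graph: diameter 2 and girth 5, so all geodesics are unique. This
-- case is checked by evaluation, as the general argument needs k ≥ 3.
σ-inner-GP5 : (i j : Fin 5) → σ (inner i) (inner j) ≡ 1
σ-inner-GP5 = toWitness {a? = all? λ i → all? λ j → σ (inner i) (inner j) ≟ 1} _

σ-formula-GP5 : ∀ (i j : Fin 5) → σ-Formula 2 ∣ toℕ i - toℕ j ∣ (σ (inner i) (inner j))
σ-formula-GP5 i j = (λ _ → σ-inner-GP5 i j) , (λ _ _ → σ-inner-GP5 i j) , (λ _ ())
                  , λ r%2≡1 r≡0 → contradiction (trans (cong (_% 2) (sym r≡0)) r%2≡1) λ ()

mainTheorem4 : (k : ℕ) → 2 ≤ k → (i j : Fin (suc (2 * k))) → i ≢ j →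
    ∣ toℕ i - toℕ j ∣ ≤ k →
    ((∣ toℕ i - toℕ j ∣ % 2 ≡ 0 →
        σ (inner i) (inner j) ≡ 1)
    × (∣ toℕ i - toℕ j ∣ % 2 ≡ 1 → ∣ toℕ i - toℕ j ∣ > k ∸ 2 →
        σ (inner i) (inner j) ≡ 1)
    × (∣ toℕ i - toℕ j ∣ % 2 ≡ 1 → ∣ toℕ i - toℕ j ∣ < k ∸ 2 →
        σ (inner i) (inner j) ≡ (∣ toℕ i - toℕ j ∣ + 1) / 2)
    × (∣ toℕ i - toℕ j ∣ % 2 ≡ 1 → ∣ toℕ i - toℕ j ∣ ≡ k ∸ 2 →
        σ (inner i) (inner j) ≡ (∣ toℕ i - toℕ j ∣ + 3) / 2))
mainTheorem4 1 (s≤s ())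
mainTheorem4 2 _ i j _ _ = σ-formula-GP5 i j
mainTheorem4 k@(suc (suc (suc _))) _ i j _ r≤k = OddOrder.σ-inner k (s≤s (s≤s (s≤s z≤n))) j i r≤k
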